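{- Let $\mathbf{\Omega}$ be a chain and let $\overline{\mathbf{\Omega}}$ be its integral extension. Then the assignment $f\mapsto\overline{f}$ is an $\ell$-pregroup embedding of $\mathbf{F}(\mathbf{\Omega})$ into $\mathbf{F}(\overline{\mathbf{\Omega}})$.
   Context: For a map $f$ on a chain, $f^{r}$ denotes its residual ($f(a)\le b\iff a\le f^r(b)$) and $f^{\ell}$ its dual residual ($f^{\ell}(a)\le b\iff a\le f(b)$), when they exist. For a chain $\mathbf{\Omega}$, $F(\mathbf{\Omega})$ is the set of order-preserving maps on $\Omega$ with residuals of all orders and dual residuals of all orders; $\mathbf{F}(\mathbf{\Omega})$ is the $\ell$-pregroup on $F(\mathbf{\Omega})$ with composition, identity map, pointwise lattice order, and $f\mapsto f^{\ell}$, $f\mapsto f^{r}$. Let $\Omega^{ - }=\{a\in\Omega: a=\bigvee_{b<a}b\}$ and $\Omega^{+}=\{a\in\Omega: a=\bigwedge_{a<b}b\}$. The chain $\overline{\mathbf{\Omega}}$ has underlying set $\Omega\cup\{(k,a):a\in\Omega^{+},k\in\mathbb{Z}^{+}\}\cup\{(-k,a):a\in\Omega^{ - },k\in\mathbb{Z}^{+}\}$, where each $a\in\Omega$ is identified with $(0,a)$; writing $ka$ for $(k,a)$, the order is $ka\leq nb$ iff $a<b$ or ($a=b$ and $k\leq n$). For $f\in F(\mathbf{\Omega})$ and $kb\in\overline{\Omega}$ define $\overline{f}(kb)=f(b)$ if $|f^{ -1}[f(b)]|>1$ or $k=0$, and $\overline{f}(kb)=k\,f(b)$ (i.e., $(k,f(b))$)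 if $|f^{ -1}[f(b)]|=1$ and $k\neq 0$. -}

module Defs where

open import Level using (Level; _⊔_) renaming (suc to lsuc)
open import Data.Integer as ℤ using (ℤ; +_; -[1+_])
open import Data.Nat using (zero; suc)
open import Data.Unit using (⊤; tt)
open import Data.Product using (_×_; _,_; proj₁; proj₂)
open import Data.Sum using (_⊎_)
open import Relation.Binary.Core using (Rel)
open import Relation.Binary.Structures using (IsTotalOrder)
open import Relation.Binary.PropositionalEquality using (_≡_; _≢_; refl; sym; subst; cong)
open import Relation.Nullary using (Dec; yes; no; ¬_)

-- Excluded middle at universe level c (needed to decide whether
-- |f⁻¹[f(b)]| = 1, which is not decidable constructively).
LEM : (c : Level) → Set (lsuc c)
LEM c = (P : Set c) → Dec P

record Chain (c ℓ : Level) : Set (lsuc (c ⊔ ℓ)) where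
  field
    Carrier      : Set c
    _≤_          : Rel Carrier ℓ
    isTotalOrder : IsTotalOrder _≡_ _≤_
  open IsTotalOrder isTotalOrder public

module _ {a r} {A : Set a} (_≤_ : Rel A r) where

  OrderPreserving : (A → A) → Set (a ⊔ r)
  OrderPreserving f = ∀ {x y} → x ≤ y → f x ≤ f y

  IsResidual : (A → A) → (A → A) → Set (a ⊔ r)
  IsResidual f g = ∀ x y → (f x ≤ y → x ≤ g y) × (x ≤ g y → f x ≤ y)

  -- f ∈ F(A): f is order-preserving and has residuals and dual residuals
  -- of all orders, i.e. there is a ℤ-indexed family (…, f^ℓℓ, f^ℓ, f, f^r, f^rr, …)
  -- with fam 0 = f and fam (n+1) the residual of fam n.
  record InF (f : A → A) : Set (a ⊔ r) where
    field
      preserves : OrderPreserving f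
      fam       : ℤ → A → A
      fam-zero  : ∀ x → fam (+ 0) x ≡ f x
      fam-res   : ∀ n → IsResidual (fam n) (fam (ℤ.suc n))

  -- pointwise meet / join (the lattice order of F is pointwise)
  IsPwMeet : (h f g : A → A) → Set (a ⊔ r)
  IsPwMeet h f g = ∀ x → (h x ≤ f x) × (h x ≤ g x) × (∀ z → z ≤ f x → z ≤ g x → z ≤ h x)

  IsPwJoin : (h f g : A → A) → Set (a ⊔ r)
  IsPwJoin h f g = ∀ x → (f x ≤ h x) × (g x ≤ h x) × (∀ z → f x ≤ z → g x ≤ z → h x ≤ z)

module Ext {c ℓ} (Ω : Chain c ℓ) where
  open Chain Ω

  _<_ : Rel Carrier (c ⊔ ℓ)
  x < y = (x ≤ y) × (x ≢ y)

  InΩ⁻ : Carrier → Set (c ⊔ ℓ)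
  InΩ⁻ a = ∀ e → (∀ b → b < a → b ≤ e) → a ≤ e

  InΩ⁺ : Carrier → Set (c ⊔ ℓ)
  InΩ⁺ a = ∀ e → (∀ b → a < b → e ≤ b) → e ≤ a

  Valid : ℤ → Carrier → Set (c ⊔ ℓ)
  Valid (+ zero)    a = Level.Lift (c ⊔ ℓ) ⊤
  Valid (+ (suc n)) a = InΩ⁺ a
  Valid -[1+ n ]    a = InΩ⁻ a

  -- elements k a of Ω̄ (a ∈ Ω is identified with 0 a); validity proof irrelevant
  record Pt : Set (c ⊔ ℓ) where
    constructor mk
    field
      idx   : ℤ
      pt    : Carrier
      .valid : Valid idx pt
  open Pt public

  ι : Carrier → Pt
  ι a = mk (+ 0) a (Level.lift tt)

  _≤̄_ : Rel Pt (c ⊔ ℓ)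
  p ≤̄ q = (pt p < pt q) ⊎ ((pt p ≡ pt q) × (idx p ℤ.≤ idx q))

  InjAt : (Carrier → Carrier) → Carrier → Set c
  InjAt f b = ∀ x → f x ≡ f b → x ≡ b

  valid-img : ∀ f (pf : InF _≤_ f) k b → Valid k b → InjAt f b → Valid k (f b)
  valid-img f pf (+ zero) b v inj = Level.lift tt
  valid-img f pf (+ (suc n)) b v inj = λ e hyp →
    subst (e ≤_) (InF.fam-zero pf b)
      (proj₁ (InF.fam-res pf -[1+ 0 ] e b)
        (v (L e) λ d b<d → proj₂ (InF.fam-res pf -[1+ 0 ] e d)
          (subst (e ≤_) (sym (InF.fam-zero pf d))
            (hyp (f d) (InF.preserves pf (proj₁ b<d) ,
                        λ eq → proj₂ b<d (sym (inj d (sym eq))))))))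
    where L = InF.fam pf -[1+ 0 ]
  valid-img f pf -[1+ n ] b v inj = λ e hyp →
    subst (_≤ e) (InF.fam-zero pf b)
      (proj₂ (InF.fam-res pf (+ 0) b e)
        (v (R e) λ d d<b → proj₁ (InF.fam-res pf (+ 0) d e)
          (subst (_≤ e) (sym (InF.fam-zero pf d))
            (hyp (f d) (InF.preserves pf (proj₁ d<b) ,
                        λ eq → proj₂ d<b (inj d eq))))))
    where R = InF.fam pf (+ 1)

  overline : LEM c → (f : Carrier → Carrier) → InF _≤_ f → Pt → Pt
  overline lem f pf (mk k b v) with lem (InjAt f b)
  ... | yes inj = mk k (f b) (valid-img f pf k b v inj)
  ... | no _    = mk (+ 0) (f b) (Level.lift tt)

  record IsLPregroupEmbedding (lem : LEM c) : Set (lsuc (c ⊔ ℓ)) where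
    ov = overline lem
    field
      into     : ∀ f (pf : InF _≤_ f) → InF _≤̄_ (ov f pf)
      comp     : ∀ f g h (pf : InF _≤_ f) (pg : InF _≤_ g) (ph : InF _≤_ h) →
                 (∀ a → h a ≡ f (g a)) → ∀ x → ov h ph x ≡ ov f pf (ov g pg x)
      ident    : ∀ h (ph : InF _≤_ h) → (∀ a → h a ≡ a) → ∀ x → ov h ph x ≡ x
      meet     : ∀ f g h (pf : InF _≤_ f) (pg : InF _≤_ g) (ph : InF _≤_ h) →
                 IsPwMeet _≤_ h f g → IsPwMeet _≤̄_ (ov h ph) (ov f pf) (ov g pg)
      join     : ∀ f g h (pf : InF _≤_ f) (pg : InF _≤_ g) (ph : InF _≤_ h) →
                 IsPwJoin _≤_ h f g → IsPwJoin _≤̄_ (ov h ph) (ov f pf) (ov g pg)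
      -- preserves residuals (h = f^r) and dual residuals (f = h^ℓ)
      residual : ∀ f h (pf : InF _≤_ f) (ph : InF _≤_ h) →
                 IsResidual _≤_ f h → IsResidual _≤̄_ (ov f pf) (ov h ph)
      injective : ∀ f g (pf : InF _≤_ f) (pg : InF _≤_ g) →
                  (∀ x → ov f pf x ≡ ov g pg x) → ∀ a → f a ≡ g a

-- Write f̄(k b) = (κ, f b), where the index κ is k if f is injective at b and 0
-- otherwise. Every clause of the theorem then splits into a statement about the
-- points f b, which is the corresponding fact in Ω, and a statement about the
-- indices, which compares injectivity of the maps involved. The indices can only
-- disagree at a point a carrying a nonzero index, i.e. at a ∈ Ω⁺ (or Ω⁻). There
-- the existence of residuals and dual residuals makes f continuous from the right
-- (left), so injectivity of f at a amounts to f(a) < f(z) for all z > a (z < a),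
-- and this local condition is what composition, meets and residuation preserve.
-- Residuals are checked through unit and counit, and joins are reduced to meets
-- by passing to residuals.

module Submission where

open import Defs
open import Level using (Level; _⊔_)
open import Data.Integer as ℤ using (ℤ; +_; -[1+_]; _⊓_)
import Data.Integer.Properties as ℤP
open import Data.Nat using (zero; suc; z≤n)
open import Data.Product using (_×_; _,_; proj₁; proj₂)
open import Data.Sum using (_⊎_; inj₁; inj₂; [_,_])
open import Data.Empty using (⊥; ⊥-elim)
import Data.Empty.Irrelevant as Irrelevant
open import Function using (_∘_; _⇔_; mk⇔; Equivalence)
open import Relation.Binary.Core using (Rel)
open import Relation.Binary.Bundles using (TotalOrder)
open import Relation.Binary.Structures using (IsPreorder)
open import Relation.Binary.Definitions using (Trichotomous; tri<; tri≈; tri>)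
import Relation.Binary.Construct.NonStrictToStrict as NonStrictToStrict
import Relation.Binary.Properties.TotalOrder as TotalOrderProperties
open import Relation.Binary.PropositionalEquality
  using (_≡_; refl; sym; trans; subst; cong; cong₂) renaming (isEquivalence to ≡-isEquivalence)
open import Relation.Nullary using (yes; no; ¬_)

IsMin : ∀ {a r} {A : Set a} → Rel A r → A → A → A → Set (a ⊔ r)
IsMin _≤_ m x y = (m ≡ x × x ≤ y) ⊎ (m ≡ y × y ≤ x)

pwMeet-comm : ∀ {a r} {A : Set a} {_≤_ : Rel A r} {f g h : A → A} →
              IsPwMeet _≤_ h f g → IsPwMeet _≤_ h g f
pwMeet-comm meet x with meet x
... | h≤f , h≤g , glb = h≤g , h≤f , λ z z≤gx z≤fx → glb z z≤fx z≤gx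

module Residuation {a r} {A : Set a} {_≤_ : Rel A r} (isPreorder : IsPreorder _≡_ _≤_) where
  open IsPreorder isPreorder renaming (refl to ≤-refl; trans to ≤-trans)

  module _ {f g : A → A} (f⊣g : IsResidual _≤_ f g) where

    residual-unit : ∀ x → x ≤ g (f x)
    residual-unit x = proj₁ (f⊣g x (f x)) ≤-refl

    residual-counit : ∀ y → f (g y) ≤ y
    residual-counit y = proj₂ (f⊣g (g y) y) ≤-refl

    residual-monoˡ : OrderPreserving _≤_ f
    residual-monoˡ {x} {y} x≤y = proj₂ (f⊣g x (f y)) (≤-trans x≤y (residual-unit y))

    residual-monoʳ : OrderPreserving _≤_ g
    residual-monoʳ {x} {y} x≤y = proj₁ (f⊣g (g x) y) (≤-trans (residual-counit x) x≤y)

  residual-from-unit-counit : ∀ {f g} → OrderPreserving _≤_ f → OrderPreserving _≤_ g →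
                              (∀ x → x ≤ g (f x)) → (∀ y → f (g y) ≤ y) → IsResidual _≤_ f g
  residual-from-unit-counit f-mono g-mono unit counit x y =
    (λ fx≤y → ≤-trans (unit x) (g-mono fx≤y)) , (λ x≤gy → ≤-trans (f-mono x≤gy) (counit y))

  pwMeet-from-IsMin : ∀ {f g h} → (∀ x → IsMin _≤_ (h x) (f x) (g x)) → IsPwMeet _≤_ h f g
  pwMeet-from-IsMin min x with min x
  ... | inj₁ (hx≡fx , fx≤gx) rewrite hx≡fx = ≤-refl , fx≤gx , λ _ z≤fx _ → z≤fx
  ... | inj₂ (hx≡gx , gx≤fx) rewrite hx≡gx = gx≤fx , ≤-refl , λ _ _ z≤gx → z≤gx

  pwMeet-residuals : ∀ {f g h fʳ gʳ hʳ} →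
                     IsResidual _≤_ f fʳ → IsResidual _≤_ g gʳ → IsResidual _≤_ h hʳ →
                     IsPwJoin _≤_ h f g → IsPwMeet _≤_ hʳ fʳ gʳ
  pwMeet-residuals {hʳ = hʳ} f⊣fʳ g⊣gʳ h⊣hʳ join y =
    proj₁ (f⊣fʳ _ y) (≤-trans (proj₁ (join (hʳ y))) (residual-counit h⊣hʳ y)) ,
    proj₁ (g⊣gʳ _ y) (≤-trans (proj₁ (proj₂ (join (hʳ y)))) (residual-counit h⊣hʳ y)) ,
    λ z z≤fʳy z≤gʳy → proj₁ (h⊣hʳ z y)
      (proj₂ (proj₂ (join z)) y (proj₂ (f⊣fʳ z y) z≤fʳy) (proj₂ (g⊣gʳ z y) z≤gʳy))

  pwJoin-from-residuals : ∀ {f g h fʳ gʳ hʳ} →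
                          IsResidual _≤_ f fʳ → IsResidual _≤_ g gʳ → IsResidual _≤_ h hʳ →
                          IsPwMeet _≤_ hʳ fʳ gʳ → IsPwJoin _≤_ h f g
  pwJoin-from-residuals {h = h} f⊣fʳ g⊣gʳ h⊣hʳ meet x =
    proj₂ (f⊣fʳ x (h x)) (≤-trans (residual-unit h⊣hʳ x) (proj₁ (meet (h x)))) ,
    proj₂ (g⊣gʳ x (h x)) (≤-trans (residual-unit h⊣hʳ x) (proj₁ (proj₂ (meet (h x))))) ,
    λ z fx≤z gx≤z → proj₂ (h⊣hʳ x z)
      (proj₂ (proj₂ (meet z)) x (proj₁ (f⊣fʳ x z) fx≤z) (proj₁ (g⊣gʳ x z) gx≤z))

  module _ {f : A → A} (pf : InF _≤_ f) where
    open InF pf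

    InF-residual : IsResidual _≤_ f (fam (+ 1))
    InF-residual x y rewrite sym (fam-zero x) = fam-res (+ 0) x y

    InF-dual-residual : IsResidual _≤_ (fam -[1+ 0 ]) f
    InF-dual-residual x y rewrite sym (fam-zero y) = fam-res -[1+ 0 ] x y

    InF-fam : ∀ n → InF _≤_ (fam n)
    InF-fam n = record
      { preserves = residual-monoˡ (fam-res n)
      ; fam       = λ m → fam (m ℤ.+ n)
      ; fam-zero  = λ x → cong (λ i → fam i x) (ℤP.+-identityˡ n)
      ; fam-res   = λ m → subst (λ i → IsResidual _≤_ (fam (m ℤ.+ n)) (fam i))
                                (sym (ℤP.+-assoc (+ 1) m n)) (fam-res (m ℤ.+ n))
      }

-- Reindex (InjAt f b) k κ says that κ is the index of f̄(k b).
data Reindex {p} (P : Set p) (k : ℤ) : ℤ → Set p where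
  keep  : P → Reindex P k k
  reset : ¬ P → Reindex P k (+ 0)

private
  variable
    ℓ₁ ℓ₂ ℓ₃ : Level
    P : Set ℓ₁
    Q : Set ℓ₂
    L : Set ℓ₃
    i i′ k k′ k₁ k₂ : ℤ

reindex-keep : P → Reindex P k k′ → k′ ≡ k
reindex-keep _ (keep _)    = refl
reindex-keep p (reset ¬p) = ⊥-elim (¬p p)

reindex-reset : ¬ P → Reindex P k k′ → k′ ≡ + 0
reindex-reset ¬p (keep p)  = ⊥-elim (¬p p)
reindex-reset _  (reset _) = refl

reindex-zero : Reindex P (+ 0) k′ → k′ ≡ + 0
reindex-zero (keep _)  = refl
reindex-zero (reset _) = refl

reindex-mono : i ℤ.≤ k → Reindex P i i′ → Reindex P k k′ → i′ ℤ.≤ k′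
reindex-mono i≤k (keep _)   (keep _)   = i≤k
reindex-mono _   (reset _)  (reset _)  = ℤP.≤-refl
reindex-mono _   (keep p)   (reset ¬p) = ⊥-elim (¬p p)
reindex-mono _   (reset ¬p) (keep p)   = ⊥-elim (¬p p)

reindex-unique : .L → (L → P ⇔ Q) → Reindex P k k₁ → Reindex Q k k₂ → k₁ ≡ k₂
reindex-unique _ _   (keep _)   (keep _)   = refl
reindex-unique _ _   (reset _)  (reset _)  = refl
reindex-unique l P⇔Q (keep p)   (reset ¬q) = Irrelevant.⊥-elim (¬q (Equivalence.to (P⇔Q l) p))
reindex-unique l P⇔Q (reset ¬p) (keep q)   = Irrelevant.⊥-elim (¬p (Equivalence.from (P⇔Q l) q))

reindex-∘ : Reindex P k k₁ → Reindex Q k₁ k₂ → Reindex (P × Q) k k₂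
reindex-∘ (keep p)   (keep q)   = keep (p , q)
reindex-∘ (keep _)   (reset ¬q) = reset (¬q ∘ proj₂)
reindex-∘ (reset ¬p) (keep _)   = reset (¬p ∘ proj₁)
reindex-∘ (reset ¬p) (reset _)  = reset (¬p ∘ proj₁)

reindex-⊓-× : + 0 ℤ.≤ k → Reindex P k k₁ → Reindex Q k k₂ →
              Reindex (P × Q) k (k₁ ⊓ k₂)
reindex-⊓-× {k = k} _ (keep p) (keep q) =
  subst (Reindex _ k) (sym (ℤP.⊓-idem k)) (keep (p , q))
reindex-⊓-× 0≤k (keep _) (reset ¬q) =
  subst (Reindex _ _) (sym (ℤP.i≥j⇒i⊓j≡j 0≤k)) (reset (¬q ∘ proj₂))
reindex-⊓-× 0≤k (reset ¬p) (keep _) =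
  subst (Reindex _ _) (sym (ℤP.i≤j⇒i⊓j≡i 0≤k)) (reset (¬p ∘ proj₁))
reindex-⊓-× _ (reset ¬p) (reset _) = reset (¬p ∘ proj₁)

reindex-⊓-⊎ : k ℤ.≤ + 0 → Reindex P k k₁ → Reindex Q k k₂ →
              Reindex (P ⊎ Q) k (k₁ ⊓ k₂)
reindex-⊓-⊎ {k = k} _ (keep p) (keep _) =
  subst (Reindex _ k) (sym (ℤP.⊓-idem k)) (keep (inj₁ p))
reindex-⊓-⊎ k≤0 (keep p) (reset _) =
  subst (Reindex _ _) (sym (ℤP.i≤j⇒i⊓j≡i k≤0)) (keep (inj₁ p))
reindex-⊓-⊎ k≤0 (reset _) (keep q) =
  subst (Reindex _ _) (sym (ℤP.i≥j⇒i⊓j≡j k≤0)) (keep (inj₂ q))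
reindex-⊓-⊎ _ (reset ¬p) (reset ¬q) = reset [ ¬p , ¬q ]

⊓-selection : ∀ m n → (m ⊓ n ≡ m × m ℤ.≤ n) ⊎ (m ⊓ n ≡ n × n ℤ.≤ m)
⊓-selection m n with ℤP.⊓-sel m n
... | inj₁ m⊓n≡m = inj₁ (m⊓n≡m , ℤP.i⊓j≡i⇒i≤j m⊓n≡m)
... | inj₂ m⊓n≡n = inj₂ (m⊓n≡n , ℤP.i⊓j≡j⇒j≤i m⊓n≡n)

module Overline {c ℓ : Level} (lem : LEM c) (Ω : Chain c ℓ) where
  open Chain Ω renaming (refl to ≤-refl; trans to ≤-trans)
  open Ext Ω
  open Residuation isPreorder
  open InF using (preserves)

  totalOrder : TotalOrder c c ℓ
  totalOrder = record { isTotalOrder = isTotalOrder }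

  open TotalOrderProperties totalOrder using (≰⇒≥; <⇒≱; <-trans)

  <-trichotomous : Trichotomous _≡_ _<_
  <-trichotomous = NonStrictToStrict.<-trichotomous _≡_ _≤_ sym (λ x y → lem (x ≡ y)) antisym total

  -- the points of Ω that can carry a nonzero index in Ω̄
  Limit : Carrier → Set (c ⊔ ℓ)
  Limit a = InΩ⁺ a ⊎ InΩ⁻ a

  residual-preserves-Ω⁺ : ∀ {g f a e} → IsResidual _≤_ g f → InΩ⁺ a →
                          (∀ z → a < z → e ≤ f z) → e ≤ f a
  residual-preserves-Ω⁺ g⊣f a∈Ω⁺ e≤f =
    proj₁ (g⊣f _ _) (a∈Ω⁺ _ λ z a<z → proj₂ (g⊣f _ _) (e≤f z a<z))

  dual-residual-preserves-Ω⁻ : ∀ {f g a e} → IsResidual _≤_ f g → InΩ⁻ a →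
                               (∀ z → z < a → f z ≤ e) → f a ≤ e
  dual-residual-preserves-Ω⁻ f⊣g a∈Ω⁻ f≤e =
    proj₂ (f⊣g _ _) (a∈Ω⁻ _ λ z z<a → proj₁ (f⊣g _ _) (f≤e z z<a))

  -- The dual residual fˡ is itself a residual, so it preserves the meet over the
  -- right of a; this gives a ≤ fˡ(f a), which rules out f x = f a for x < a.
  injAt-Ω⁺ : ∀ {f a} → InF _≤_ f → InΩ⁺ a → (∀ z → a < z → ¬ (f z ≤ f a)) → InjAt f a
  injAt-Ω⁺ {f} {a} pf a∈Ω⁺ rising x fx≡fa with <-trichotomous x a
  ... | tri≈ _ x≡a _ = x≡a
  ... | tri> _ _ a<x = ⊥-elim (rising x a<x (reflexive fx≡fa))
  ... | tri< x<a _ _ = ⊥-elim (<⇒≱ x<a (≤-trans a≤fˡfa fˡfa≤x))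
    where
    open InF pf

    fˡ⊣f : IsResidual _≤_ (fam -[1+ 0 ]) f
    fˡ⊣f = InF-dual-residual pf

    fˡˡ⊣fˡ : IsResidual _≤_ (fam -[1+ 1 ]) (fam -[1+ 0 ])
    fˡˡ⊣fˡ = fam-res -[1+ 1 ]

    fˡfa≤x : fam -[1+ 0 ] (f a) ≤ x
    fˡfa≤x = proj₂ (fˡ⊣f _ _) (reflexive (sym fx≡fa))

    a≤fˡfa : a ≤ fam -[1+ 0 ] (f a)
    a≤fˡfa = proj₁ (fˡˡ⊣fˡ _ _) (residual-preserves-Ω⁺ fˡ⊣f a∈Ω⁺ λ z a<z →
      proj₂ (fˡˡ⊣fˡ _ _) (≰⇒≥ λ fˡfz≤a → rising z a<z (proj₁ (fˡ⊣f _ _) fˡfz≤a)))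

  injAt-Ω⁻ : ∀ {f a} → InF _≤_ f → InΩ⁻ a → (∀ z → z < a → ¬ (f a ≤ f z)) → InjAt f a
  injAt-Ω⁻ {f} {a} pf a∈Ω⁻ falling x fx≡fa with <-trichotomous x a
  ... | tri≈ _ x≡a _ = x≡a
  ... | tri< x<a _ _ = ⊥-elim (falling x x<a (reflexive (sym fx≡fa)))
  ... | tri> _ _ a<x = ⊥-elim (<⇒≱ a<x (≤-trans x≤fʳfa fʳfa≤a))
    where
    open InF pf

    f⊣fʳ : IsResidual _≤_ f (fam (+ 1))
    f⊣fʳ = InF-residual pf

    fʳ⊣fʳʳ : IsResidual _≤_ (fam (+ 1)) (fam (+ 2))
    fʳ⊣fʳʳ = fam-res (+ 1)

    x≤fʳfa : x ≤ fam (+ 1) (f a)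
    x≤fʳfa = proj₁ (f⊣fʳ _ _) (reflexive fx≡fa)

    fʳfa≤a : fam (+ 1) (f a) ≤ a
    fʳfa≤a = proj₂ (fʳ⊣fʳʳ _ _) (dual-residual-preserves-Ω⁻ f⊣fʳ a∈Ω⁻ λ z z<a →
      proj₁ (fʳ⊣fʳʳ _ _) (≰⇒≥ λ a≤fʳfz → falling z z<a (proj₂ (f⊣fʳ _ _) a≤fʳfz)))

  injAt-resp-≗ : ∀ {f g a} → (∀ x → f x ≡ g x) → InjAt f a → InjAt g a
  injAt-resp-≗ {a = a} f≗g f-inj x gx≡ga = f-inj x (trans (f≗g x) (trans gx≡ga (sym (f≗g a))))

  injAt-raise⁺ : ∀ {f h a} → InF _≤_ f → OrderPreserving _≤_ h → (∀ z → h z ≤ f z) →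
                 h a ≡ f a → InΩ⁺ a → InjAt h a → InjAt f a
  injAt-raise⁺ pf h-mono h≤f ha≡fa a∈Ω⁺ h-inj = injAt-Ω⁺ pf a∈Ω⁺ λ z a<z fz≤fa →
    proj₂ a<z (sym (h-inj z (antisym (≤-trans (h≤f z) (≤-trans fz≤fa (reflexive (sym ha≡fa))))
                                    (h-mono (proj₁ a<z)))))

  injAt-lower⁻ : ∀ {f h a} → OrderPreserving _≤_ f → InF _≤_ h → (∀ z → h z ≤ f z) →
                 h a ≡ f a → InΩ⁻ a → InjAt f a → InjAt h a
  injAt-lower⁻ f-mono ph h≤f ha≡fa a∈Ω⁻ f-inj = injAt-Ω⁻ ph a∈Ω⁻ λ z z<a ha≤hz →
    proj₂ z<a (f-inj z (antisym (f-mono (proj₁ z<a))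
                                (≤-trans (reflexive (sym ha≡fa)) (≤-trans ha≤hz (h≤f z)))))

  module PwMeet {f g h : Carrier → Carrier} (pf : InF _≤_ f) (pg : InF _≤_ g) (ph : InF _≤_ h)
                (meet : IsPwMeet _≤_ h f g) where

    h≤f : ∀ z → h z ≤ f z
    h≤f z = proj₁ (meet z)

    h≤g : ∀ z → h z ≤ g z
    h≤g z = proj₁ (proj₂ (meet z))

    ≤-meet : ∀ {e z} → e ≤ f z → e ≤ g z → e ≤ h z
    ≤-meet {z = z} = proj₂ (proj₂ (meet z)) _

    meet-selects : ∀ y → h y ≡ f y ⊎ h y ≡ g y
    meet-selects y with total (f y) (g y)
    ... | inj₁ fy≤gy = inj₁ (antisym (h≤f y) (≤-meet ≤-refl fy≤gy))
    ... | inj₂ gy≤fy = inj₂ (antisym (h≤g y) (≤-meet gy≤fy ≤-refl))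

    meet-≡ˡ : ∀ {a} → f a ≤ g a → h a ≡ f a
    meet-≡ˡ fa≤ga = antisym (h≤f _) (≤-meet ≤-refl fa≤ga)

    injAt⇒¬ha≤f∧g : ∀ {a m} → InjAt h a → m < a → h a ≤ f m → h a ≤ g m → ⊥
    injAt⇒¬ha≤f∧g h-inj (m≤a , m≢a) ha≤fm ha≤gm =
      m≢a (h-inj _ (antisym (preserves ph m≤a) (≤-meet ha≤fm ha≤gm)))

    injAt⇒¬ha≤f∧g-below : ∀ {a z w} → InjAt h a → z < a → w < a → h a ≤ f z → h a ≤ g w → ⊥
    injAt⇒¬ha≤f∧g-below {z = z} {w} h-inj z<a w<a ha≤fz ha≤gw with total z w
    ... | inj₁ z≤w = injAt⇒¬ha≤f∧g h-inj w<a (≤-trans ha≤fz (preserves pf z≤w)) ha≤gw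
    ... | inj₂ w≤z = injAt⇒¬ha≤f∧g h-inj z<a ha≤fz (≤-trans ha≤gw (preserves pg w≤z))

    injAt-meet-< : ∀ {a} → f a < g a → InjAt f a → InjAt h a
    injAt-meet-< {a} fa<ga f-inj y hy≡ha = f-inj y (fy≡fa (meet-selects y))
      where
      hy≡fa : h y ≡ f a
      hy≡fa = trans hy≡ha (meet-≡ˡ (proj₁ fa<ga))

      fy≡fa : h y ≡ f y ⊎ h y ≡ g y → f y ≡ f a
      fy≡fa (inj₁ hy≡fy) = trans (sym hy≡fy) hy≡fa
      fy≡fa (inj₂ hy≡gy) = antisym (preserves pf y≤a) (≤-trans (reflexive (sym hy≡fa)) (h≤f y))
        where
        y≤a : y ≤ a
        y≤a = ≰⇒≥ λ a≤y → <⇒≱ fa<ga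
          (subst (g a ≤_) (trans (sym hy≡gy) hy≡fa) (preserves pg a≤y))

    injAt-meet-<-Limit : ∀ {a} → f a < g a → Limit a → InjAt h a → InjAt f a
    injAt-meet-<-Limit fa<ga (inj₁ a∈Ω⁺) =
      injAt-raise⁺ pf (preserves ph) h≤f (meet-≡ˡ (proj₁ fa<ga)) a∈Ω⁺
    injAt-meet-<-Limit {a} fa<ga (inj₂ a∈Ω⁻) h-inj = injAt-Ω⁻ pf a∈Ω⁻ λ z z<a fa≤fz →
      <⇒≱ fa<ga (dual-residual-preserves-Ω⁻ (InF-residual pg) a∈Ω⁻ λ w w<a →
        ≰⇒≥ λ fa≤gw → injAt⇒¬ha≤f∧g-below h-inj z<a w<a (ha≤ fa≤fz) (ha≤ fa≤gw))
      where
      ha≤ : ∀ {e} → f a ≤ e → h a ≤ e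
      ha≤ = ≤-trans (h≤f a)

    module _ {a} (fa≡ga : f a ≡ g a) where

      ha≡fa : h a ≡ f a
      ha≡fa = meet-≡ˡ (reflexive fa≡ga)

      ha≡ga : h a ≡ g a
      ha≡ga = trans ha≡fa fa≡ga

      injAt-meet-≡ : InjAt f a → InjAt g a → InjAt h a
      injAt-meet-≡ f-inj g-inj y hy≡ha with meet-selects y
      ... | inj₁ hy≡fy = f-inj y (trans (sym hy≡fy) (trans hy≡ha ha≡fa))
      ... | inj₂ hy≡gy = g-inj y (trans (sym hy≡gy) (trans hy≡ha ha≡ga))

      injAt-meet-≡-Ω⁺ : InΩ⁺ a → InjAt h a ⇔ (InjAt f a × InjAt g a)
      injAt-meet-≡-Ω⁺ a∈Ω⁺ = mk⇔
        (λ h-inj → injAt-raise⁺ pf (preserves ph) h≤f ha≡fa a∈Ω⁺ h-inj ,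
                   injAt-raise⁺ pg (preserves ph) h≤g ha≡ga a∈Ω⁺ h-inj)
        (λ (f-inj , g-inj) → injAt-meet-≡ f-inj g-inj)

      injAt-meet-≡-Ω⁻ : InΩ⁻ a → InjAt h a ⇔ (InjAt f a ⊎ InjAt g a)
      injAt-meet-≡-Ω⁻ a∈Ω⁻ = mk⇔ split
        [ injAt-lower⁻ (preserves pf) ph h≤f ha≡fa a∈Ω⁻ ,
          injAt-lower⁻ (preserves pg) ph h≤g ha≡ga a∈Ω⁻ ]
        where
        split : InjAt h a → InjAt f a ⊎ InjAt g a
        split h-inj with lem (InjAt f a)
        ... | yes f-inj = inj₁ f-inj
        ... | no ¬f-inj = inj₂ (injAt-Ω⁻ pg a∈Ω⁻ λ w w<a ga≤gw →
                ¬f-inj (injAt-Ω⁻ pf a∈Ω⁻ λ z z<a fa≤fz →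
                  injAt⇒¬ha≤f∧g-below h-inj z<a w<a
                    (subst (_≤ f z) (sym ha≡fa) fa≤fz) (subst (_≤ g w) (sym ha≡ga) ga≤gw)))

  module Composite {f g h : Carrier → Carrier} (pf : InF _≤_ f) (pg : InF _≤_ g)
                   (h≗f∘g : ∀ a → h a ≡ f (g a)) where

    injAt-∘ : ∀ {a} → InjAt g a → InjAt f (g a) → InjAt h a
    injAt-∘ {a} g-inj f-inj y hy≡ha =
      g-inj y (f-inj (g y) (trans (sym (h≗f∘g y)) (trans hy≡ha (h≗f∘g a))))

    injAt-∘-inner : ∀ {a} → InjAt h a → InjAt g a
    injAt-∘-inner {a} h-inj y gy≡ga =
      h-inj y (trans (h≗f∘g y) (trans (cong f gy≡ga) (sym (h≗f∘g a))))

    hz≡ha : ∀ {a z} → f (g z) ≤ f (g a) → f (g a) ≤ f (g z) → h z ≡ h a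
    hz≡ha {a} {z} fgz≤fga fga≤fgz =
      trans (h≗f∘g z) (trans (antisym fgz≤fga fga≤fgz) (sym (h≗f∘g a)))

    injAt-∘-outer-Ω⁺ : ∀ {a} → InΩ⁺ a → InjAt h a → InjAt g a → InjAt f (g a)
    injAt-∘-outer-Ω⁺ {a} a∈Ω⁺ h-inj g-inj =
      injAt-Ω⁺ pf (valid-img g pg (+ 1) a a∈Ω⁺ g-inj) λ w ga<w fw≤fga →
        <⇒≱ ga<w (residual-preserves-Ω⁺ (InF-dual-residual pg) a∈Ω⁺ λ z a<z →
          ≰⇒≥ λ gz≤w → proj₂ a<z (sym (h-inj z (hz≡ha
            (≤-trans (preserves pf gz≤w) fw≤fga)
            (preserves pf (preserves pg (proj₁ a<z)))))))

    injAt-∘-outer-Ω⁻ : ∀ {a} → InΩ⁻ a → InjAt h a → InjAt g a → InjAt f (g a)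
    injAt-∘-outer-Ω⁻ {a} a∈Ω⁻ h-inj g-inj =
      injAt-Ω⁻ pf (valid-img g pg -[1+ 0 ] a a∈Ω⁻ g-inj) λ w w<ga fga≤fw →
        <⇒≱ w<ga (dual-residual-preserves-Ω⁻ (InF-residual pg) a∈Ω⁻ λ z z<a →
          ≰⇒≥ λ w≤gz → proj₂ z<a (h-inj z (hz≡ha
            (preserves pf (preserves pg (proj₁ z<a)))
            (≤-trans fga≤fw (preserves pf w≤gz)))))

    injAt-∘-split : ∀ {a} → Limit a → InjAt h a → InjAt g a × InjAt f (g a)
    injAt-∘-split (inj₁ a∈Ω⁺) h-inj =
      injAt-∘-inner h-inj , injAt-∘-outer-Ω⁺ a∈Ω⁺ h-inj (injAt-∘-inner h-inj)
    injAt-∘-split (inj₂ a∈Ω⁻) h-inj =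
      injAt-∘-inner h-inj , injAt-∘-outer-Ω⁻ a∈Ω⁻ h-inj (injAt-∘-inner h-inj)

  module _ {f h : Carrier → Carrier} (f⊣h : IsResidual _≤_ f h) where

    injAt-unit-Ω⁺ : ∀ {a} → InF _≤_ f → a ≡ h (f a) → InΩ⁺ a → InjAt f a × InjAt h (f a)
    injAt-unit-Ω⁺ {a} pf a≡hfa a∈Ω⁺ = f-inj , h-inj
      where
      f-inj : InjAt f a
      f-inj = injAt-Ω⁺ pf a∈Ω⁺ λ z a<z fz≤fa → <⇒≱ a<z
        (≤-trans (residual-unit f⊣h z) (≤-trans (residual-monoʳ f⊣h fz≤fa) (reflexive (sym a≡hfa))))

      h-inj : InjAt h (f a)
      h-inj y hy≡hfa = antisym
        (residual-preserves-Ω⁺ (InF-dual-residual pf) a∈Ω⁺ λ z a<z → ≰⇒≥ λ fz≤y → <⇒≱ a<z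
          (≤-trans (proj₁ (f⊣h z y) fz≤y) (reflexive (trans hy≡hfa (sym a≡hfa)))))
        (proj₂ (f⊣h a y) (reflexive (trans a≡hfa (sym hy≡hfa))))

    injAt-counit-Ω⁻ : ∀ {b} → InF _≤_ h → f (h b) ≡ b → InΩ⁻ b → InjAt h b × InjAt f (h b)
    injAt-counit-Ω⁻ {b} ph fhb≡b b∈Ω⁻ = h-inj , f-inj
      where
      h-inj : InjAt h b
      h-inj = injAt-Ω⁻ ph b∈Ω⁻ λ z z<b hb≤hz → <⇒≱ z<b
        (≤-trans (reflexive (sym fhb≡b))
                 (≤-trans (residual-monoˡ f⊣h hb≤hz) (residual-counit f⊣h z)))

      f-inj : InjAt f (h b)
      f-inj x fx≡fhb = antisym
        (proj₁ (f⊣h x b) (reflexive (trans fx≡fhb fhb≡b)))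
        (dual-residual-preserves-Ω⁻ (InF-residual ph) b∈Ω⁻ λ z z<b → ≰⇒≥ λ x≤hz → <⇒≱ z<b
          (≤-trans (reflexive (trans (sym fhb≡b) (sym fx≡fhb))) (proj₂ (f⊣h x z) x≤hz)))

  reindex-unique-Limit : ∀ {a} → .(Valid k a) → (Limit a → P ⇔ Q) →
                         Reindex P k k₁ → Reindex Q k k₂ → k₁ ≡ k₂
  reindex-unique-Limit {k = + zero}   _ _   r₁ r₂ = trans (reindex-zero r₁) (sym (reindex-zero r₂))
  reindex-unique-Limit {k = + suc _}  v P⇔Q r₁ r₂ = reindex-unique v (P⇔Q ∘ inj₁) r₁ r₂
  reindex-unique-Limit {k = -[1+ _ ]} v P⇔Q r₁ r₂ = reindex-unique v (P⇔Q ∘ inj₂) r₁ r₂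

  ≤-reindex-Ω⁺ : ∀ {a} → .(Valid k a) → (InΩ⁺ a → P) → Reindex P k k′ → k ℤ.≤ k′
  ≤-reindex-Ω⁺                 _ _    (keep _)   = ℤP.≤-refl
  ≤-reindex-Ω⁺ {k = + zero}   _ _    (reset _)  = ℤP.≤-refl
  ≤-reindex-Ω⁺ {k = + suc _}  v Ω⁺⇒P (reset ¬P) = Irrelevant.⊥-elim (¬P (Ω⁺⇒P v))
  ≤-reindex-Ω⁺ {k = -[1+ _ ]} _ _    (reset _)  = ℤ.-≤+

  reindex-≤-Ω⁻ : ∀ {a} → .(Valid k a) → (InΩ⁻ a → P) → Reindex P k k′ → k′ ℤ.≤ k
  reindex-≤-Ω⁻                 _ _    (keep _)   = ℤP.≤-refl
  reindex-≤-Ω⁻ {k = + zero}   _ _    (reset _)  = ℤP.≤-refl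
  reindex-≤-Ω⁻ {k = + suc _}  _ _    (reset _)  = ℤ.+≤+ z≤n
  reindex-≤-Ω⁻ {k = -[1+ _ ]} v Ω⁻⇒P (reset ¬P) = Irrelevant.⊥-elim (¬P (Ω⁻⇒P v))

  Pt-≡ : ∀ {u w : Pt} → idx u ≡ idx w → pt u ≡ pt w → u ≡ w
  Pt-≡ {mk _ _ _} {mk _ _ _} refl refl = refl

  ≤̄-trans : ∀ {p q s : Pt} → p ≤̄ q → q ≤̄ s → p ≤̄ s
  ≤̄-trans     (inj₁ p<q)         (inj₁ q<s)         = inj₁ (<-trans p<q q<s)
  ≤̄-trans {p} (inj₁ p<q)         (inj₂ (q≡s , _))   = inj₁ (subst (pt p <_) q≡s p<q)
  ≤̄-trans {s = s} (inj₂ (p≡q , _)) (inj₁ q<s)       = inj₁ (subst (_< pt s) (sym p≡q) q<s)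
  ≤̄-trans     (inj₂ (p≡q , i≤j)) (inj₂ (q≡s , j≤k)) = inj₂ (trans p≡q q≡s , ℤP.≤-trans i≤j j≤k)

  ≤̄-reflexive : ∀ {p q : Pt} → p ≡ q → p ≤̄ q
  ≤̄-reflexive refl = inj₂ (refl , ℤP.≤-refl)

  ≤̄-isPreorder : IsPreorder _≡_ _≤̄_
  ≤̄-isPreorder = record
    { isEquivalence = ≡-isEquivalence
    ; reflexive     = ≤̄-reflexive
    ; trans         = λ {p q s} → ≤̄-trans {p} {q} {s}
    }

  ≤̄-resp-pt : ∀ p q {x y} → pt p ≡ x → pt q ≡ y →
              (x < y) ⊎ (x ≡ y × idx p ℤ.≤ idx q) → p ≤̄ q
  ≤̄-resp-pt _ _ refl refl p≤̄q = p≤̄q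

  ov : (f : Carrier → Carrier) → InF _≤_ f → Pt → Pt
  ov = overline lem

  pt-overline : ∀ {f} (pf : InF _≤_ f) p → pt (ov f pf p) ≡ f (pt p)
  pt-overline {f} pf (mk k b v) with lem (InjAt f b)
  ... | yes _ = refl
  ... | no _  = refl

  idx-overline : ∀ {f} (pf : InF _≤_ f) p → Reindex (InjAt f (pt p)) (idx p) (idx (ov f pf p))
  idx-overline {f} pf (mk k b v) with lem (InjAt f b)
  ... | yes f-inj = keep f-inj
  ... | no ¬f-inj = reset ¬f-inj

  ≤̄-overline : ∀ {f g} (pf : InF _≤_ f) (pg : InF _≤_ g) p q →
               (f (pt p) < g (pt q)) ⊎ (f (pt p) ≡ g (pt q) × idx (ov f pf p) ℤ.≤ idx (ov g pg q)) →
               ov f pf p ≤̄ ov g pg q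
  ≤̄-overline pf pg p q = ≤̄-resp-pt (ov _ pf p) (ov _ pg q) (pt-overline pf p) (pt-overline pg q)

  overline-≡ : ∀ {f g} (pf : InF _≤_ f) (pg : InF _≤_ g) p →
               idx (ov f pf p) ≡ idx (ov g pg p) → f (pt p) ≡ g (pt p) → ov f pf p ≡ ov g pg p
  overline-≡ pf pg p idx-≡ fp≡gp =
    Pt-≡ idx-≡ (trans (pt-overline pf p) (trans fp≡gp (sym (pt-overline pg p))))

  pt-overline-∘ : ∀ {f g} (pf : InF _≤_ f) (pg : InF _≤_ g) p →
                  pt (ov f pf (ov g pg p)) ≡ f (g (pt p))
  pt-overline-∘ {f} pf pg p = trans (pt-overline pf (ov _ pg p)) (cong f (pt-overline pg p))

  idx-overline-∘ : ∀ {f g} (pf : InF _≤_ f) (pg : InF _≤_ g) p →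
                   Reindex (InjAt g (pt p) × InjAt f (g (pt p))) (idx p) (idx (ov f pf (ov g pg p)))
  idx-overline-∘ {f} {g} pf pg p = reindex-∘ (idx-overline pg p)
    (subst (λ b → Reindex (InjAt f b) (idx (ov g pg p)) (idx (ov f pf (ov g pg p))))
           (pt-overline pg p) (idx-overline pf (ov _ pg p)))

  overline-cong : ∀ {f g} (pf : InF _≤_ f) (pg : InF _≤_ g) → (∀ a → f a ≡ g a) →
                  ∀ p → ov f pf p ≡ ov g pg p
  overline-cong pf pg f≗g p@(mk k a v) =
    overline-≡ pf pg p
      (reindex-unique-Limit v (λ _ → mk⇔ (injAt-resp-≗ f≗g) (injAt-resp-≗ (sym ∘ f≗g)))
                            (idx-overline pf p) (idx-overline pg p))
      (f≗g a)

  overline-mono : ∀ {f} (pf : InF _≤_ f) → OrderPreserving _≤̄_ (ov f pf)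
  overline-mono pf {p@(mk _ a _)} {q@(mk _ .a _)} (inj₂ (refl , k≤n)) =
    ≤̄-overline pf pf p q (inj₂ (refl , reindex-mono k≤n (idx-overline pf p) (idx-overline pf q)))
  overline-mono {f} pf {p@(mk _ a _)} {q@(mk _ b _)} (inj₁ a<b) with lem (f a ≡ f b)
  ... | no fa≢fb = ≤̄-overline pf pf p q (inj₁ (preserves pf (proj₁ a<b) , fa≢fb))
  ... | yes fa≡fb = ≤̄-overline pf pf p q (inj₂ (fa≡fb , ℤP.≤-reflexive (trans kp≡0 (sym kq≡0))))
    where
    kp≡0 : idx (ov f pf p) ≡ + 0
    kp≡0 = reindex-reset (λ a-inj → proj₂ a<b (sym (a-inj b (sym fa≡fb)))) (idx-overline pf p)

    kq≡0 : idx (ov f pf q) ≡ + 0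
    kq≡0 = reindex-reset (λ b-inj → proj₂ a<b (b-inj a fa≡fb)) (idx-overline pf q)

  overline-residual : ∀ {f h} (pf : InF _≤_ f) (ph : InF _≤_ h) → IsResidual _≤_ f h →
                      IsResidual _≤̄_ (ov f pf) (ov h ph)
  overline-residual {f} {h} pf ph f⊣h =
    Residuation.residual-from-unit-counit ≤̄-isPreorder {ov f pf} {ov h ph}
      (overline-mono pf) (overline-mono ph) unit counit
    where
    unit : ∀ p → p ≤̄ ov h ph (ov f pf p)
    unit p@(mk k a v) with lem (a ≡ h (f a))
    ... | no a≢hfa  = ≤̄-resp-pt p (ov h ph (ov f pf p)) refl (pt-overline-∘ ph pf p)
      (inj₁ (residual-unit f⊣h a , a≢hfa))
    ... | yes a≡hfa = ≤̄-resp-pt p (ov h ph (ov f pf p)) refl (pt-overline-∘ ph pf p)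
      (inj₂ (a≡hfa , ≤-reindex-Ω⁺ v (injAt-unit-Ω⁺ f⊣h pf a≡hfa) (idx-overline-∘ ph pf p)))

    counit : ∀ q → ov f pf (ov h ph q) ≤̄ q
    counit q@(mk n b w) with lem (f (h b) ≡ b)
    ... | no fhb≢b  = ≤̄-resp-pt (ov f pf (ov h ph q)) q (pt-overline-∘ pf ph q) refl
      (inj₁ (residual-counit f⊣h b , fhb≢b))
    ... | yes fhb≡b = ≤̄-resp-pt (ov f pf (ov h ph q)) q (pt-overline-∘ pf ph q) refl
      (inj₂ (fhb≡b , reindex-≤-Ω⁻ w (injAt-counit-Ω⁻ f⊣h ph fhb≡b) (idx-overline-∘ pf ph q)))

  overline-InF : ∀ {f} (pf : InF _≤_ f) → InF _≤̄_ (ov f pf)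
  overline-InF pf = record
    { preserves = overline-mono pf
    ; fam       = λ n → ov (fam n) (InF-fam pf n)
    ; fam-zero  = overline-cong (InF-fam pf (+ 0)) pf fam-zero
    ; fam-res   = λ n → overline-residual (InF-fam pf n) (InF-fam pf (ℤ.suc n)) (fam-res n)
    }
    where open InF pf

  overline-∘ : ∀ {f g h} (pf : InF _≤_ f) (pg : InF _≤_ g) (ph : InF _≤_ h) →
               (∀ a → h a ≡ f (g a)) → ∀ p → ov h ph p ≡ ov f pf (ov g pg p)
  overline-∘ pf pg ph h≗f∘g p@(mk k a v) =
    Pt-≡ (reindex-unique-Limit v (λ lim → mk⇔ (injAt-∘-split lim) (λ (g-inj , f-inj) → injAt-∘ g-inj f-inj))
                              (idx-overline ph p) (idx-overline-∘ pf pg p))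
         (trans (pt-overline ph p) (trans (h≗f∘g a) (sym (pt-overline-∘ pf pg p))))
    where open Composite pf pg h≗f∘g

  overline-id : ∀ {h} (ph : InF _≤_ h) → (∀ a → h a ≡ a) → ∀ p → ov h ph p ≡ p
  overline-id {h} ph h≗id p =
    Pt-≡ (reindex-keep h-inj (idx-overline ph p)) (trans (pt-overline ph p) (h≗id (pt p)))
    where
    h-inj : InjAt h (pt p)
    h-inj y hy≡hp = trans (sym (h≗id y)) (trans hy≡hp (h≗id (pt p)))

  overline-injective : ∀ {f g} (pf : InF _≤_ f) (pg : InF _≤_ g) →
                       (∀ p → ov f pf p ≡ ov g pg p) → ∀ a → f a ≡ g a
  overline-injective pf pg f̄≗ḡ a =
    trans (sym (pt-overline pf (ι a))) (trans (cong pt (f̄≗ḡ (ι a))) (pt-overline pg (ι a)))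

  module _ {f g h : Carrier → Carrier} (pf : InF _≤_ f) (pg : InF _≤_ g) (ph : InF _≤_ h)
           (meet : IsPwMeet _≤_ h f g) where
    open PwMeet pf pg ph meet

    overline-meet-< : ∀ p → f (pt p) < g (pt p) → ov h ph p ≡ ov f pf p × ov f pf p ≤̄ ov g pg p
    overline-meet-< p@(mk k a v) fa<ga =
      overline-≡ ph pf p
        (reindex-unique-Limit v (λ lim → mk⇔ (injAt-meet-<-Limit fa<ga lim) (injAt-meet-< fa<ga))
                              (idx-overline ph p) (idx-overline pf p))
        (meet-≡ˡ (proj₁ fa<ga)) ,
      ≤̄-overline pf pg p p (inj₁ fa<ga)

    reindex-meet-≡ : ∀ {a k kf kg kh} → f a ≡ g a → .(Valid k a) →
                   Reindex (InjAt f a) k kf → Reindex (InjAt g a) k kg → Reindex (InjAt h a) k kh →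
                   kh ≡ kf ⊓ kg
    reindex-meet-≡ {k = + zero} _ _ rf rg rh =
      trans (reindex-zero rh) (sym (cong₂ _⊓_ (reindex-zero rf) (reindex-zero rg)))
    reindex-meet-≡ {k = + suc _} fa≡ga v rf rg rh =
      reindex-unique v (injAt-meet-≡-Ω⁺ fa≡ga) rh (reindex-⊓-× (ℤ.+≤+ z≤n) rf rg)
    reindex-meet-≡ {k = -[1+ _ ]} fa≡ga v rf rg rh =
      reindex-unique v (injAt-meet-≡-Ω⁻ fa≡ga) rh (reindex-⊓-⊎ ℤ.-≤+ rf rg)

    overline-meet-≡ : ∀ p → f (pt p) ≡ g (pt p) → IsMin _≤̄_ (ov h ph p) (ov f pf p) (ov g pg p)
    overline-meet-≡ p@(mk k a v) fa≡ga
      with reindex-meet-≡ fa≡ga v (idx-overline pf p) (idx-overline pg p) (idx-overline ph p)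
         | ⊓-selection (idx (ov f pf p)) (idx (ov g pg p))
    ... | kh≡kf⊓kg | inj₁ (⊓≡kf , kf≤kg) =
      inj₁ (overline-≡ ph pf p (trans kh≡kf⊓kg ⊓≡kf) (ha≡fa fa≡ga) ,
            ≤̄-overline pf pg p p (inj₂ (fa≡ga , kf≤kg)))
    ... | kh≡kf⊓kg | inj₂ (⊓≡kg , kg≤kf) =
      inj₂ (overline-≡ ph pg p (trans kh≡kf⊓kg ⊓≡kg) (ha≡ga fa≡ga) ,
            ≤̄-overline pg pf p p (inj₂ (sym fa≡ga , kg≤kf)))

  overline-meet : ∀ {f g h} (pf : InF _≤_ f) (pg : InF _≤_ g) (ph : InF _≤_ h) →
                  IsPwMeet _≤_ h f g → IsPwMeet _≤̄_ (ov h ph) (ov f pf) (ov g pg)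
  overline-meet {f} {g} {h} pf pg ph meet =
    Residuation.pwMeet-from-IsMin ≤̄-isPreorder {ov f pf} {ov g pg} {ov h ph} min
    where
    min : ∀ p → IsMin _≤̄_ (ov h ph p) (ov f pf p) (ov g pg p)
    min p with <-trichotomous (f (pt p)) (g (pt p))
    ... | tri< fa<ga _ _ = inj₁ (overline-meet-< pf pg ph meet p fa<ga)
    ... | tri≈ _ fa≡ga _ = overline-meet-≡ pf pg ph meet p fa≡ga
    ... | tri> _ _ ga<fa = inj₂ (overline-meet-< pg pf ph (pwMeet-comm {_≤_ = _≤_} meet) p ga<fa)

  overline-join : ∀ {f g h} (pf : InF _≤_ f) (pg : InF _≤_ g) (ph : InF _≤_ h) →
                  IsPwJoin _≤_ h f g → IsPwJoin _≤̄_ (ov h ph) (ov f pf) (ov g pg)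
  overline-join {f} {g} {h} pf pg ph join =
    Residuation.pwJoin-from-residuals ≤̄-isPreorder
      {ov f pf} {ov g pg} {ov h ph} {ovʳ pf} {ovʳ pg} {ovʳ ph}
      (overline-⊣ pf) (overline-⊣ pg) (overline-⊣ ph)
      (overline-meet (InF-fam pf (+ 1)) (InF-fam pg (+ 1)) (InF-fam ph (+ 1))
        (pwMeet-residuals (InF-residual pf) (InF-residual pg) (InF-residual ph) join))
    where
    ovʳ : ∀ {u} → InF _≤_ u → Pt → Pt
    ovʳ pu = ov (InF.fam pu (+ 1)) (InF-fam pu (+ 1))

    overline-⊣ : ∀ {u} (pu : InF _≤_ u) → IsResidual _≤̄_ (ov u pu) (ovʳ pu)
    overline-⊣ pu = overline-residual pu (InF-fam pu (+ 1)) (InF-residual pu)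

theorem2p10 : ∀ {c ℓ : Level} (lem : LEM c) (Ω : Chain c ℓ) → Ext.IsLPregroupEmbedding Ω lem
theorem2p10 lem Ω = record
  { into      = λ _ → overline-InF
  ; comp      = λ _ _ _ → overline-∘
  ; ident     = λ _ → overline-id
  ; meet      = λ _ _ _ → overline-meet
  ; join      = λ _ _ _ → overline-join
  ; residual  = λ _ _ → overline-residual
  ; injective = λ _ _ → overline-injective
  }
  where open Overline lem Ω
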